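{- Let $T,T'$ be $[n]$-decorated $(m+1)$-ary trees, let $v_1\prec_T\cdots\prec_T v_p$ be the vertices of $T$ and $w_1\prec_{T'}\cdots\prec_{T'}w_{p'}$ the vertices of $T'$. Let $q$ be an integer with $1\le q\le\min(p,p')$. If $v_i\simeq w_i$ for all $i\in[q-1]$, then $\rho(v_i)=\rho(w_i)$ for all $i\in[q]$ (where $[0]=\varnothing$).
   Context: An $(m+1)$-ary tree ($m\ge1$) is a rooted plane tree in which every vertex has $m+1$ or $0$ children; childless vertices are leaves, others nodes; the rank of a non-root vertex is the number of its siblings preceding it in the child order. An $[n]$-decorated $(m+1)$-ary tree is an $(m+1)$-ary tree whose nodes are labeled by nonempty subsets of $[n]$ forming a set partition of $[n]$, with certain edges (from a node to its highest-rank child of positive rank that is a node) declared solid or dashed. For a vertex $u$, $\rho(u)$ is the word in $\{E_0,\dots,E_m\}$ recording the ranks of the edges on the path from the root to $u$, and $\dot\rho(u)$ is the sum of these ranks. For distinct vertices $u,w$ of $T$: $u\prec_T w$ iff $\dot\rho(u)<\dot\rho(w)$, or $\dot\rho(u)=\dot\rho(w)$ and either $\rho(u)$ is a proper prefix of $\rho(w)$ or at the first differing position $\rho(u)$ has $E_b$ and $\rho(w)$ has $E_a$ with $a<b$. For a vertex $v$ of $T$ and a vertex $w$ of $T'$, $v\simeq w$ means that both are leaves or both are nodes. -}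

module Defs where

open import Data.Nat using (ℕ; zero; suc; _+_; _<_; _≤_)
open import Data.Fin using (Fin; toℕ)
open import Data.Fin.Subset using (Subset; _∈_; _∩_; Empty; Nonempty)
open import Data.Vec using (Vec; []; _∷_; lookup)
open import Data.List using (List; []; _∷_; _++_; foldr; map)
open import Data.List.Relation.Unary.All using (All)
open import Data.List.Relation.Unary.Any using (Any)
open import Data.List.Relation.Unary.AllPairs using (AllPairs)
open import Data.Maybe using (Maybe; just; nothing)
open import Data.Bool using (Bool; true; false; _∨_)
open import Data.Unit using (⊤)
open import Data.Product using (Σ; ∃; _×_; _,_)
open import Relation.Binary.PropositionalEquality using (_≡_; _≢_)
open import Relation.Nullary using (¬_)

data Style : Set where
  solid dashed : Style

-- A node carries its label (a
-- subset of [n] = Fin n), an optional style for the distinguished edge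
-- (node → highest-rank child of positive rank that is a node), and its
-- m+1 children, listed by rank 0..m.
data DTree (m n : ℕ) : Set where
  leaf : DTree m n
  node : Subset n → Maybe Style → Vec (DTree m n) (suc m) → DTree m n

isNode : ∀ {m n} → DTree m n → Bool
isNode leaf         = false
isNode (node _ _ _) = true

anyNode : ∀ {m n k} → Vec (DTree m n) k → Bool
anyNode []       = false
anyNode (c ∷ cs) = isNode c ∨ anyNode cs

hasPosNodeChild : ∀ {m n} → Vec (DTree m n) (suc m) → Bool
hasPosNodeChild (_ ∷ cs) = anyNode cs

labels : ∀ {m n} → DTree m n → List (Subset n)
labelsV : ∀ {m n k} → Vec (DTree m n) k → List (Subset n)
labels leaf           = []
labels (node S _ cs)  = S ∷ labelsV cs
labelsV []       = []
labelsV (c ∷ cs) = labels c ++ labelsV cs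

StyleOK : ∀ {m n} → DTree m n → Set
StyleOKV : ∀ {m n k} → Vec (DTree m n) k → Set
StyleOK leaf = ⊤
StyleOK (node _ st cs) =
  ((∃ λ s → st ≡ just s) → hasPosNodeChild cs ≡ true) ×
  (hasPosNodeChild cs ≡ true → ∃ λ s → st ≡ just s) × StyleOKV cs
StyleOKV [] = ⊤
StyleOKV (c ∷ cs) = StyleOK c × StyleOKV cs

IsSetPartition : ∀ {n} → List (Subset n) → Set
IsSetPartition {n} Ls =
  All Nonempty Ls ×
  AllPairs (λ A B → Empty (A ∩ B)) Ls ×
  (∀ (x : Fin n) → Any (x ∈_) Ls)

IsDecorated : ∀ {m n} → DTree m n → Set
IsDecorated T = IsSetPartition (labels T) × StyleOK T

-- Words in E_0..E_m: E_a is represented by a : Fin (suc m).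
Word : ℕ → Set
Word m = List (Fin (suc m))

weight : ∀ {m} → Word m → ℕ
weight = foldr (λ a k → toℕ a + k) 0

data Kind : Set where
  leafK nodeK : Kind

kindOf : ∀ {m n} → DTree m n → Kind
kindOf leaf         = leafK
kindOf (node _ _ _) = nodeK

at : ∀ {m n} → DTree m n → Word m → Maybe Kind
at T            []       = just (kindOf T)
at leaf         (_ ∷ _)  = nothing
at (node _ _ cs) (a ∷ w) = at (lookup cs a) w

-- vertices of T are identified with their words ρ(u)
IsVertex : ∀ {m n} → DTree m n → Word m → Set
IsVertex T u = ∃ λ k → at T u ≡ just k

data _≺_ {m : ℕ} : Word m → Word m → Set where
  byWeight : ∀ {u w} → weight u < weight w → u ≺ w
  byPrefix : ∀ {u w} → weight u ≡ weight w →
             (a : Fin (suc m)) (s : Word m) → w ≡ u ++ (a ∷ s) → u ≺ w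
  byDiff   : ∀ {u w} → weight u ≡ weight w →
             (c : Word m) (a b : Fin (suc m)) (r s : Word m) →
             u ≡ c ++ (b ∷ r) → w ≡ c ++ (a ∷ s) → toℕ a < toℕ b → u ≺ w

data Chain {m : ℕ} : List (Word m) → Set where
  []  : Chain []
  [-] : ∀ {u} → Chain (u ∷ [])
  _∷_ : ∀ {u w vs} → u ≺ w → Chain (w ∷ vs) → Chain (u ∷ w ∷ vs)

open import Data.List.Membership.Propositional renaming (_∈_ to _∈L_)

OrderedVertices : ∀ {m n} → DTree m n → List (Word m) → Set
OrderedVertices T vs =
  Chain vs × (∀ u → IsVertex T u → u ∈L vs) × All (IsVertex T) vs

-- Compare all words by the weight ρ̇ and then lexicographically with larger
-- letters first; this strict order contains ≺, so both vertex lists are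
-- sorted by it. Suppose the first k vertices of T and T' coincide and have
-- the same kinds. The next vertex v of T is then a vertex of T': its parent
-- precedes it, hence is among the first k, hence is a node of T' as well.
-- So v occurs in the list of T' at position ≥ k: for the next vertex w of
-- T', v = w or w ⊏ v. Symmetrically v = w or v ⊏ w, whence v = w.
module Submission where

open import Defs
open import Level using (Level; 0ℓ)
open import Data.Nat using (ℕ; zero; suc; _≤_; _<_; _⊓_; z≤n; s≤s)
open import Data.Nat.Properties
  using (≤-refl; ≤-<-trans; <⇒≤; <-irrefl; <-trans; +-monoʳ-≤; m≤n⇒m<n∨m≡n; m<1+n⇒m<n∨m≡n)
open import Data.Fin as Fin using (Fin; toℕ) renaming (zero to fzero; suc to fsuc)
import Data.Fin.Properties as Fin
open import Data.List using (List; []; _∷_; _++_; _∷ʳ_; length; lookup; take; drop)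
open import Data.List.Relation.Unary.All as All using (All; []; _∷_)
open import Data.List.Relation.Unary.AllPairs using (AllPairs; []; _∷_)
open import Data.List.Relation.Unary.Any using (here; there)
open import Data.List.Relation.Binary.Pointwise as Pointwise using (Pointwise; []; _∷_)
open import Data.List.Relation.Binary.Lex.Strict as Lex using (Lex-<; this; next; halt)
open import Data.List.Membership.Propositional using (_∈_)
open import Data.List.Membership.Propositional.Properties using (∈-++⁻; ∈-++⁺ʳ)
open import Data.List.Reverse using (reverseView; []; _∶_∶ʳ_)
open import Data.Maybe using (just)
open import Data.Product using (_×_; _,_; proj₁; proj₂)
open import Data.Product.Relation.Binary.Lex.Strict using (×-Lex; ×-transitive; ×-irreflexive)
open import Data.Sum using (_⊎_; inj₁; inj₂)
open import Data.Empty using (⊥-elim)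
import Data.Vec as Vec
open import Function using (flip)
open import Relation.Binary using (Rel; Transitive)
open import Relation.Binary.PropositionalEquality
open import Relation.Nullary using (¬_)

infix 4 _<ˡᵉˣ_ _⊏_

_<ˡᵉˣ_ : ∀ {m} → Rel (Word m) 0ℓ
_<ˡᵉˣ_ = Lex-< _≡_ Fin._>_

<ˡᵉˣ-trans : ∀ {m} → Transitive (_<ˡᵉˣ_ {m})
<ˡᵉˣ-trans = Lex.<-transitive isEquivalence (resp₂ Fin._>_) (flip Fin.<-trans)

<ˡᵉˣ-irrefl : ∀ {m} {u w : Word m} → u ≡ w → ¬ u <ˡᵉˣ w
<ˡᵉˣ-irrefl refl = Lex.<-irreflexive (λ x≡y → Fin.<-irrefl (sym x≡y)) (Pointwise.refl refl)

<ˡᵉˣ-++-∷ : ∀ {m} (u : Word m) a s → u <ˡᵉˣ u ++ a ∷ s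
<ˡᵉˣ-++-∷ []      a s = halt
<ˡᵉˣ-++-∷ (x ∷ u) a s = next refl (<ˡᵉˣ-++-∷ u a s)

<ˡᵉˣ-branch : ∀ {m} (c : Word m) {a b r s} → a Fin.< b → c ++ b ∷ r <ˡᵉˣ c ++ a ∷ s
<ˡᵉˣ-branch []      a<b = this a<b
<ˡᵉˣ-branch (x ∷ c) a<b = next refl (<ˡᵉˣ-branch c a<b)

_⊏_ : ∀ {m} → Rel (Word m) 0ℓ
u ⊏ w = ×-Lex _≡_ _<_ _<ˡᵉˣ_ (weight u , u) (weight w , w)

⊏-trans : ∀ {m} {u v w : Word m} → u ⊏ v → v ⊏ w → u ⊏ w
⊏-trans {u = u} {v} {w} =
  ×-transitive isEquivalence (resp₂ _<_) <-trans <ˡᵉˣ-trans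
    {weight u , u} {weight v , v} {weight w , w}

⊏-irrefl : ∀ {m} {u : Word m} → ¬ u ⊏ u
⊏-irrefl {u = u} =
  ×-irreflexive {_≈₁_ = _≡_} {_<₁_ = _<_} {_≈₂_ = _≡_} {_<₂_ = _<ˡᵉˣ_} <-irrefl <ˡᵉˣ-irrefl
    {weight u , u} (refl , refl)

≺⇒⊏ : ∀ {m} {u w : Word m} → u ≺ w → u ⊏ w
≺⇒⊏ (byWeight u<w)                       = inj₁ u<w
≺⇒⊏ (byPrefix u≡w a s refl)              = inj₂ (u≡w , <ˡᵉˣ-++-∷ _ a s)
≺⇒⊏ (byDiff u≡w c a b r s refl refl a<b) = inj₂ (u≡w , <ˡᵉˣ-branch c a<b)

weight-≤-∷ʳ : ∀ {m} (p : Word m) a → weight p ≤ weight (p ∷ʳ a)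
weight-≤-∷ʳ []      a = z≤n
weight-≤-∷ʳ (x ∷ p) a = +-monoʳ-≤ (toℕ x) (weight-≤-∷ʳ p a)

⊏-∷ʳ : ∀ {m} (p : Word m) a → p ⊏ p ∷ʳ a
⊏-∷ʳ p a with m≤n⇒m<n∨m≡n (weight-≤-∷ʳ p a)
... | inj₁ lighter    = inj₁ lighter
... | inj₂ sameWeight = inj₂ (sameWeight , <ˡᵉˣ-++-∷ p a [])

Chain⇒sorted : ∀ {m} {vs : List (Word m)} → Chain vs → AllPairs _⊏_ vs
Chain⇒sorted []  = []
Chain⇒sorted [-] = [] ∷ []
Chain⇒sorted (u≺w ∷ chain) with Chain⇒sorted chain
... | w⊏vs ∷ sorted = (≺⇒⊏ u≺w ∷ All.map (⊏-trans (≺⇒⊏ u≺w)) w⊏vs) ∷ w⊏vs ∷ sorted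

Indexwise : ∀ {a ℓ} {A : Set a} → Rel A ℓ → ℕ → List A → List A → Set ℓ
Indexwise R k xs ys = ∀ i j → toℕ i ≡ toℕ j → toℕ i < k → R (lookup xs i) (lookup ys j)

module _ {a ℓ : Level} {A : Set a} {R : Rel A ℓ} where

  sorted-before : ∀ xs {y ys} → AllPairs R (xs ++ y ∷ ys) → All (λ x → R x y) xs
  sorted-before []       _          = []
  sorted-before (x ∷ xs) (Rx ∷ Rxs) =
    All.lookup Rx (∈-++⁺ʳ xs (here refl)) ∷ sorted-before xs Rxs

  sorted-after : ∀ xs {y ys} → AllPairs R (xs ++ y ∷ ys) → All (R y) ys
  sorted-after []       (Ry ∷ _)  = Ry
  sorted-after (x ∷ xs) (_ ∷ Rxs) = sorted-after xs Rxs

  sorted-∈ : ∀ xs {y ys u} → AllPairs R (xs ++ y ∷ ys) → u ∈ xs ++ y ∷ ys →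
             u ∈ xs ⊎ u ≡ y ⊎ R y u
  sorted-∈ xs sorted u∈ with ∈-++⁻ xs u∈
  ... | inj₁ u∈xs         = inj₁ u∈xs
  ... | inj₂ (here u≡y)   = inj₂ (inj₁ u≡y)
  ... | inj₂ (there u∈ys) = inj₂ (inj₂ (All.lookup (sorted-after xs sorted) u∈ys))

  take-pointwise : ∀ k {xs ys : List A} → k ≤ length xs → k ≤ length ys →
                   Indexwise R k xs ys → Pointwise R (take k xs) (take k ys)
  take-pointwise zero    _ _ _ = []
  take-pointwise (suc k) {_ ∷ _} {_ ∷ _} (s≤s k≤∣xs∣) (s≤s k≤∣ys∣) related =
    related fzero fzero refl (s≤s z≤n) ∷
    take-pointwise k k≤∣xs∣ k≤∣ys∣
      (λ i j i≡j i<k → related (fsuc i) (fsuc j) (cong suc i≡j) (s≤s i<k))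

  Indexwise-induction : ∀ q {xs ys : List A} →
    (∀ i j → toℕ i ≡ toℕ j → toℕ i < q → Indexwise R (toℕ i) xs ys →
       R (lookup xs i) (lookup ys j)) →
    Indexwise R q xs ys
  Indexwise-induction q {xs} {ys} step = below q ≤-refl
    where
    below : ∀ k → k ≤ q → Indexwise R k xs ys
    below zero    _   _ _ _   ()
    below (suc k) k<q i j i≡j i<1+k with m<1+n⇒m<n∨m≡n i<1+k
    ... | inj₁ i<k  = below k (<⇒≤ k<q) i j i≡j i<k
    ... | inj₂ refl = step i j i≡j k<q (below k (<⇒≤ k<q))

  Pointwise-≡×R⇒≡×All : ∀ {xs ys} → Pointwise (λ x y → x ≡ y × R x y) xs ys →
                         xs ≡ ys × All (λ x → R x x) xs
  Pointwise-≡×R⇒≡×All []                  = refl , []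
  Pointwise-≡×R⇒≡×All ((refl , Rxx) ∷ ps) with Pointwise-≡×R⇒≡×All ps
  ... | refl , Rs = refl , Rxx ∷ Rs

take-lookup-drop : ∀ {a} {A : Set a} (xs : List A) (i : Fin (length xs)) →
                   take (toℕ i) xs ++ lookup xs i ∷ drop (suc (toℕ i)) xs ≡ xs
take-lookup-drop (x ∷ xs) fzero    = refl
take-lookup-drop (x ∷ xs) (fsuc i) = cong (x ∷_) (take-lookup-drop xs i)

module _ {m n : ℕ} where

  parent-isNode : (T : DTree m n) (p : Word m) (a : Fin (suc m)) →
                  IsVertex T (p ∷ʳ a) → at T p ≡ just nodeK
  parent-isNode (node _ _ _)  []      a _      = refl
  parent-isNode (node _ _ cs) (b ∷ p) a vertex = parent-isNode (Vec.lookup cs b) p a vertex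

  child-isVertex : (T : DTree m n) (p : Word m) (a : Fin (suc m)) →
                   at T p ≡ just nodeK → IsVertex T (p ∷ʳ a)
  child-isVertex (node _ _ _)  []      a _      = _ , refl
  child-isVertex (node _ _ cs) (b ∷ p) a p-node = child-isVertex (Vec.lookup cs b) p a p-node

  next-vertex-isVertex : (T T' : DTree m n) {pre vs : List (Word m)} {v : Word m} →
    OrderedVertices T (pre ++ v ∷ vs) → All (λ u → at T u ≡ at T' u) pre → IsVertex T' v
  next-vertex-isVertex T T' {pre = pre} {v = v} (chain , complete , vertices) kinds
    with reverseView v
  ... | []         = _ , refl
  ... | p ∶ _ ∶ʳ a = child-isVertex T' p a (trans (sym (All.lookup kinds p∈pre)) p-node)
    where
    p-node : at T p ≡ just nodeK
    p-node = parent-isNode T p a (All.lookup vertices (∈-++⁺ʳ pre (here refl)))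
    p∈pre : p ∈ pre
    p∈pre with sorted-∈ pre (Chain⇒sorted chain) (complete p (nodeK , p-node))
    ... | inj₁ p∈pre      = p∈pre
    ... | inj₂ (inj₁ p≡v) = ⊥-elim (⊏-irrefl (subst (p ⊏_) (sym p≡v) (⊏-∷ʳ p a)))
    ... | inj₂ (inj₂ v⊏p) = ⊥-elim (⊏-irrefl (⊏-trans v⊏p (⊏-∷ʳ p a)))

  vertex-at-or-after : (T : DTree m n) {pre ws : List (Word m)} {v w : Word m} →
    OrderedVertices T (pre ++ w ∷ ws) → IsVertex T v → All (_⊏ v) pre → v ≡ w ⊎ w ⊏ v
  vertex-at-or-after T {pre = pre} {v = v} (chain , complete , _) v-vertex pre⊏v
    with sorted-∈ pre (Chain⇒sorted chain) (complete v v-vertex)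
  ... | inj₁ v∈pre    = ⊥-elim (⊏-irrefl (All.lookup pre⊏v v∈pre))
  ... | inj₂ v≡w⊎w⊏v = v≡w⊎w⊏v

  next-vertices-agree : (T T' : DTree m n) {pre vs ws : List (Word m)} {v w : Word m} →
    OrderedVertices T (pre ++ v ∷ vs) → OrderedVertices T' (pre ++ w ∷ ws) →
    All (λ u → at T u ≡ at T' u) pre → v ≡ w
  next-vertices-agree T T' {pre} ovs ows kinds
    with vertex-at-or-after T' ows (next-vertex-isVertex T T' ovs kinds)
                                   (sorted-before pre (Chain⇒sorted (proj₁ ovs)))
       | vertex-at-or-after T ovs (next-vertex-isVertex T' T ows (All.map sym kinds))
                                  (sorted-before pre (Chain⇒sorted (proj₁ ows)))
  ... | inj₁ v≡w | _        = v≡w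
  ... | inj₂ _   | inj₁ w≡v = sym w≡v
  ... | inj₂ w⊏v | inj₂ v⊏w = ⊥-elim (⊏-irrefl (⊏-trans v⊏w w⊏v))

  lookup-vertices-agree : (T T' : DTree m n) {vs ws : List (Word m)} →
    OrderedVertices T vs → OrderedVertices T' ws → ∀ i j →
    take (toℕ i) vs ≡ take (toℕ j) ws → All (λ u → at T u ≡ at T' u) (take (toℕ i) vs) →
    lookup vs i ≡ lookup ws j
  lookup-vertices-agree T T' {vs} {ws} ovs ows i j same-prefix kinds =
    next-vertices-agree T T' ovs-split ows-split kinds
    where
    ovs-split : OrderedVertices T (take (toℕ i) vs ++ lookup vs i ∷ drop (suc (toℕ i)) vs)
    ovs-split = subst (OrderedVertices T) (sym (take-lookup-drop vs i)) ovs
    ows-split : OrderedVertices T' (take (toℕ i) vs ++ lookup ws j ∷ drop (suc (toℕ j)) ws)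
    ows-split = subst (λ pre → OrderedVertices T' (pre ++ lookup ws j ∷ drop (suc (toℕ j)) ws))
                      (sym same-prefix)
                      (subst (OrderedVertices T') (sym (take-lookup-drop ws j)) ows)

lemma3p3 : (m n : ℕ) → 1 ≤ m →
    (T T' : DTree m n) → IsDecorated T → IsDecorated T' →
    (vs ws : List (Word m)) → OrderedVertices T vs → OrderedVertices T' ws →
    (q : ℕ) → 1 ≤ q → q ≤ length vs ⊓ length ws →
    (∀ (i : Fin (length vs)) (j : Fin (length ws)) → toℕ i ≡ toℕ j →
       suc (toℕ i) < q → at T (lookup vs i) ≡ at T' (lookup ws j)) →
    ∀ (i : Fin (length vs)) (j : Fin (length ws)) → toℕ i ≡ toℕ j →
      toℕ i < q → lookup vs i ≡ lookup ws j
lemma3p3 m n _ T T' _ _ vs ws ovs ows q _ _ kinds =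
  Indexwise-induction {R = _≡_} q {vs} {ws} agree-at
  where
  SameKind : Rel (Word m) 0ℓ
  SameKind u w = at T u ≡ at T' w

  agree-at : ∀ i j → toℕ i ≡ toℕ j → toℕ i < q → Indexwise _≡_ (toℕ i) vs ws →
             lookup vs i ≡ lookup ws j
  agree-at i j i≡j i<q agree =
    lookup-vertices-agree T T' ovs ows i j
      (trans (proj₁ prefixes) (cong (λ k → take k ws) i≡j)) (proj₂ prefixes)
    where
    i≤∣ws∣ : toℕ i ≤ length ws
    i≤∣ws∣ = subst (_≤ length ws) (sym i≡j) (<⇒≤ (Fin.toℕ<n j))
    related : Indexwise (λ u w → u ≡ w × SameKind u w) (toℕ i) vs ws
    related i' j' i'≡j' i'<i = agree i' j' i'≡j' i'<i , kinds i' j' i'≡j' (≤-<-trans i'<i i<q)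
    prefixes : take (toℕ i) vs ≡ take (toℕ i) ws × All (λ u → SameKind u u) (take (toℕ i) vs)
    prefixes = Pointwise-≡×R⇒≡×All {R = SameKind}
                 (take-pointwise (toℕ i) (<⇒≤ (Fin.toℕ<n i)) i≤∣ws∣ related)
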